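{- Let $\theta=9/10$ and $k=6$ and consider the Ising tree model. For every circuit of depth $d$ built from fan-in-two AND and OR gates and NOT gates, computing $C:\{0,1\}^N\to\{0,1\}$, there exists a way to define $x\in\{0,1\}^{L_d}$ so that each $x_i$ is set to $0$, $1$, an input of the circuit, or the negation of an input of the circuit, such that for every choice $y$ of inputs to the circuit, $\mathbb{P}[X^{(0)}=1\mid X^{(d)}=x(y)]\ge 19/20$ if $C(y)=1$ and $\mathbb{P}[X^{(0)}=1\mid X^{(d)}=x(y)]\le 1/20$ if $C(y)=0$.
   Context: Ising tree model: on the complete $k$-ary tree of depth $d$ ($L_r$ = set of depth-$r$ vertices), the root label $X^{(0)}$ is uniform in $\{0,1\}$ and each child independently copies its parent's label with probability $(1+\theta)/2$ and takes the opposite label otherwise; $X^{(r)}$ is the vector of labels at depth $r$. -}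

module Defs where

open import Data.Nat using (ℕ; zero; suc)
open import Data.Fin using (Fin; zero; suc)
open import Data.Vec using (Vec; []; _∷_)
open import Data.Bool using (Bool; true; false; not; _∧_; _∨_; if_then_else_)
open import Data.Integer using (+_)
open import Data.Rational using (ℚ; 0ℚ; 1ℚ; _+_; _*_; _-_; _/_; _÷_; _≟_; ≢-nonZero)
open import Relation.Nullary using (yes; no)

-- Depth counts AND/OR gate levels
-- (NOT gates do not increase depth).  A circuit is
-- represented by its unfolding into a formula (unfolding a DAG circuit
-- into a tree does not change its depth or the function it computes).

data Circuit (N : ℕ) : ℕ → Set where
  input : ∀ {d} → Fin N → Circuit N d
  not-g : ∀ {d} → Circuit N d → Circuit N d
  and-g : ∀ {d} → Circuit N d → Circuit N d → Circuit N (suc d)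
  or-g  : ∀ {d} → Circuit N d → Circuit N d → Circuit N (suc d)

eval : ∀ {N d} → Circuit N d → (Fin N → Bool) → Bool
eval (input i) y = y i
eval (not-g c) y = not (eval c y)
eval (and-g c c') y = eval c y ∧ eval c' y
eval (or-g c c') y = eval c y ∨ eval c' y

data Literal (N : ℕ) : Set where
  const : Bool → Literal N
  pos   : Fin N → Literal N
  neg   : Fin N → Literal N

evalLit : ∀ {N} → Literal N → (Fin N → Bool) → Bool
evalLit (const b) y = b
evalLit (pos i) y = y i
evalLit (neg i) y = not (y i)

-- Complete k-ary tree of depth d.  A vertex of depth r is identified with
-- its path from the root, a vector in Fin k of length r; so
-- L_r = Vec (Fin k) r, and X^(r) : Vec (Fin k) r → Bool.

Level : ℕ → ℕ → Set
Level k r = Vec (Fin k) r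

prodFin : (k : ℕ) → (Fin k → ℚ) → ℚ
prodFin zero f = 1ℚ
prodFin (suc k) f = f zero * prodFin k (λ j → f (suc j))

-- probability that a child copies its parent's label: (1+θ)/2
copyProb : ℚ → ℚ
copyProb θ = (1ℚ + θ) * (+ 1 / 2)

trans : ℚ → Bool → Bool → ℚ
trans θ true  true  = copyProb θ
trans θ false false = copyProb θ
trans θ true  false = 1ℚ - copyProb θ
trans θ false true  = 1ℚ - copyProb θ

-- likelihood P[X^(d) = x | X^(0) = b] for the Ising tree model:
-- the children of the root independently get labels via 'trans', and
-- the subtree below each child is an independent copy of the process.
likelihood : (k : ℕ) → ℚ → (d : ℕ) → Bool → (Level k d → Bool) → ℚ
likelihood k θ zero b x = if x [] then (if b then 1ℚ else 0ℚ) else (if b then 0ℚ else 1ℚ)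
likelihood k θ (suc d) b x =
  prodFin k (λ j →
      trans θ b true  * likelihood k θ d true  (λ v → x (j ∷ v))
    + trans θ b false * likelihood k θ d false (λ v → x (j ∷ v)))

-- root is uniform on {0,1}
half : ℚ
half = + 1 / 2

jointRootOne : (k : ℕ) → ℚ → (d : ℕ) → (Level k d → Bool) → ℚ
jointRootOne k θ d x = half * likelihood k θ d true x

leafProb : (k : ℕ) → ℚ → (d : ℕ) → (Level k d → Bool) → ℚ
leafProb k θ d x = half * likelihood k θ d true x + half * likelihood k θ d false x

-- P[A | B] = P[A ∩ B] / P[B]  (set to 0 when P[B] = 0, which never
-- happens for 0 ≤ θ < 1)
condProb : ℚ → ℚ → ℚ
condProb a b with b ≟ 0ℚ
... | yes _ = 0ℚ
... | no b≢0 = _÷_ a b {{≢-nonZero b≢0}}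

posteriorRootOne : (k : ℕ) → ℚ → (d : ℕ) → (Level k d → Bool) → ℚ
posteriorRootOne k θ d x = condProb (jointRootOne k θ d x) (leafProb k θ d x)

-- Say that a leaf labelling x of the depth-d tree *signals* the root label v
-- when the likelihood of x given X⁽⁰⁾ = v is positive and at least 19 times
-- its likelihood given X⁽⁰⁾ = ¬v; by Bayes this forces the posterior of
-- X⁽⁰⁾ = 1 to be ≥ 19/20 (v = 1) or ≤ 1/20 (v = 0).
--
-- Passing through one edge of the channel, a subtree signalling c becomes a
-- factor that favours c by odds ≥ 19/2 and disfavours it by odds ≥ 1/19.
-- The likelihood of a depth-(d+1) labelling is the product of its six
-- children's factors, so if three subtrees are each placed under two of
-- the six children, the result signals the majority of their three labels:
-- (19/2)⁴·(1/19)² ≥ 19.  AND and OR are majorities with a constant third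
-- input, and constant labellings signal their constant, so every circuit is
-- realised gate by gate; NOT is absorbed by a polarity flag, using that
-- majority is self-dual.
module Submission where

open import Defs
open import Data.Nat using (ℕ)
open import Data.Fin using (Fin)
open import Data.Vec using (Vec)
open import Data.Bool using (Bool; true; false)
open import Data.Integer using (+_)
open import Data.Rational using (ℚ; _/_; _≤_)
open import Data.Product using (Σ; _×_)
open import Relation.Binary.PropositionalEquality using (_≡_)

open import Data.Nat using (zero; suc)
open import Data.Fin using (zero; suc)
open import Data.Vec using (_∷_)
open import Data.Bool using (not; _∧_; _∨_)
open import Data.Rational using (_<_; 0ℚ; 1ℚ; _+_; _*_; _≤?_; _<?_; NonZero; positive; nonNegative)
open import Data.Rational.Properties
open import Data.Rational.Solver using (module +-*-Solver)
open import Data.Product using (_,_)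
open import Data.Empty using (⊥-elim)
open import Relation.Binary.PropositionalEquality using (refl; sym; cong; subst; subst₂)
  renaming (trans to ≡-trans)
open import Relation.Nullary using (yes; no)
open import Relation.Nullary.Decidable using (True; toWitness)
open +-*-Solver using (solve; _:+_; _:*_; _:=_; con)

decide≤ : (a b : ℚ) → {True (a ≤? b)} → a ≤ b
decide≤ a b {t} = toWitness t

decide< : (a b : ℚ) → {True (a <? b)} → a < b
decide< a b {t} = toWitness t

*-pos : ∀ {a b} → 0ℚ < a → 0ℚ < b → 0ℚ < a * b
*-pos {a} {b} a>0 b>0 = positive⁻¹ (a * b) {{pos*pos⇒pos a {{positive a>0}} b {{positive b>0}}}}

*-nonNeg : ∀ {a b} → 0ℚ ≤ a → 0ℚ ≤ b → 0ℚ ≤ a * b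
*-nonNeg {a} {b} a≥0 b≥0 =
  nonNegative⁻¹ (a * b) {{nonNeg*nonNeg⇒nonNeg a {{nonNegative a≥0}} b {{nonNegative b≥0}}}}

*-monoˡ-≤ : ∀ {r a b} → 0ℚ ≤ r → a ≤ b → r * a ≤ r * b
*-monoˡ-≤ {r} r≥0 = *-monoˡ-≤-nonNeg r {{nonNegative r≥0}}

*-monoʳ-≤ : ∀ {r a b} → 0ℚ ≤ r → a ≤ b → a * r ≤ b * r
*-monoʳ-≤ {r} r≥0 = *-monoʳ-≤-nonNeg r {{nonNegative r≥0}}

combination-pos : ∀ α β {u w} → 0ℚ < α → 0ℚ ≤ β → 0ℚ < u → 0ℚ ≤ w → 0ℚ < α * u + β * w
combination-pos α β α>0 β≥0 u>0 w≥0 = +-mono-<-≤ (*-pos α>0 u>0) (*-nonNeg β≥0 w≥0)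

-- 'Dominates r u w': u is positive and u ≥ r·w with r, w ≥ 0, i.e. the
-- odds u : w are at least r (w may vanish).
record Dominates (r u w : ℚ) : Set where
  constructor dominates
  field
    ratio≥0 : 0ℚ ≤ r
    top>0   : 0ℚ < u
    bottom≥0 : 0ℚ ≤ w
    bound   : r * w ≤ u

dominates-* : ∀ {r u w s u′ w′} → Dominates r u w → Dominates s u′ w′ →
  Dominates (r * s) (u * u′) (w * w′)
dominates-* {r} {u} {w} {s} {u′} {w′} (dominates r≥0 u>0 w≥0 rw≤u) (dominates s≥0 u′>0 w′≥0 sw′≤u′) =
  dominates (*-nonNeg r≥0 s≥0) (*-pos u>0 u′>0) (*-nonNeg w≥0 w′≥0) (begin
    (r * s) * (w * w′) ≡⟨ regroup r s w w′ ⟩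
    (r * w) * (s * w′) ≤⟨ *-monoʳ-≤ (*-nonNeg s≥0 w′≥0) rw≤u ⟩
    u * (s * w′)       ≤⟨ *-monoˡ-≤ (<⇒≤ u>0) sw′≤u′ ⟩
    u * u′             ∎)
  where
  open ≤-Reasoning
  regroup : ∀ r s w w′ → (r * s) * (w * w′) ≡ (r * w) * (s * w′)
  regroup = solve 4 (λ r s w w′ → (r :* s) :* (w :* w′) := (r :* w) :* (s :* w′)) refl

-- Which root label a likelihood pair (L₁, L₀) = (P[x | root 1], P[x | root 0])
-- favours, and by what odds.
Favors : Bool → ℚ → ℚ → ℚ → Set
Favors true  r L₁ L₀ = Dominates r L₁ L₀
Favors false r L₁ L₀ = Dominates r L₀ L₁

favors-weaken : ∀ v {r r′ L₁ L₀} → 0ℚ ≤ r′ → r′ ≤ r → Favors v r L₁ L₀ → Favors v r′ L₁ L₀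
favors-weaken true  r′≥0 r′≤r (dominates _ u>0 w≥0 rw≤u) =
  dominates r′≥0 u>0 w≥0 (≤-trans (*-monoʳ-≤ w≥0 r′≤r) rw≤u)
favors-weaken false r′≥0 r′≤r (dominates _ u>0 w≥0 rw≤u) =
  dominates r′≥0 u>0 w≥0 (≤-trans (*-monoʳ-≤ w≥0 r′≤r) rw≤u)

favors-prodFin : ∀ v k {r L₁ L₀ : Fin k → ℚ} → (∀ j → Favors v (r j) (L₁ j) (L₀ j)) →
  Favors v (prodFin k r) (prodFin k L₁) (prodFin k L₀)
favors-prodFin v zero _ = neutral v
  where
  neutral : ∀ v → Favors v 1ℚ 1ℚ 1ℚ
  neutral true  = dominates (decide≤ 0ℚ 1ℚ) (decide< 0ℚ 1ℚ) (decide≤ 0ℚ 1ℚ) ≤-refl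
  neutral false = dominates (decide≤ 0ℚ 1ℚ) (decide< 0ℚ 1ℚ) (decide≤ 0ℚ 1ℚ) ≤-refl
favors-prodFin true (suc k) h = dominates-* (h zero) (favors-prodFin true k (λ j → h (suc j)))
favors-prodFin false (suc k) h = dominates-* (h zero) (favors-prodFin false k (λ j → h (suc j)))

-- P[subtree leaves | parent label s], from the child's two likelihoods.
channel : ℚ → Bool → ℚ → ℚ → ℚ
channel θ s L₁ L₀ = trans θ s true * L₁ + trans θ s false * L₀

channel-swap : ∀ θ s L₁ L₀ → channel θ s L₀ L₁ ≡ channel θ (not s) L₁ L₀
channel-swap θ true  L₁ L₀ = +-comm (trans θ true true * L₀) (trans θ true false * L₁)
channel-swap θ false L₁ L₀ = +-comm (trans θ false true * L₀) (trans θ false false * L₁)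

parent-favors : ∀ k θ d (x : Level k (suc d) → Bool) v (r : Fin k → ℚ) →
  (∀ j → Favors v (r j)
           (channel θ true  (likelihood k θ d true (λ u → x (j ∷ u))) (likelihood k θ d false (λ u → x (j ∷ u))))
           (channel θ false (likelihood k θ d true (λ u → x (j ∷ u))) (likelihood k θ d false (λ u → x (j ∷ u))))) →
  Favors v (prodFin k r) (likelihood k θ (suc d) true x) (likelihood k θ (suc d) false x)
parent-favors k θ d x v r = favors-prodFin v k

θ : ℚ
θ = + 9 / 10

-- For θ = 9/10 the channel keeps label 1 with probability 19/20.  Odds 19
-- for label 1 below the edge leave odds ≥ 19/2 above it ...
agree-step : ∀ {L₁ L₀} → Dominates (+ 19 / 1) L₁ L₀ →
  Dominates (+ 19 / 2) (channel θ true L₁ L₀) (channel θ false L₁ L₀)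
agree-step {L₁} {L₀} (dominates _ L₁>0 L₀≥0 19L₀≤L₁) =
  dominates (decide≤ 0ℚ (+ 19 / 2)) top>0 (<⇒≤ bottom>0) (begin
    (+ 19 / 2) * ((+ 1 / 20) * L₁ + (+ 19 / 20) * L₀)   ≡⟨ expand L₁ L₀ ⟩
    (+ 19 / 40) * L₁ + (+ 19 / 40) * ((+ 19 / 1) * L₀) ≤⟨ +-monoʳ-≤ ((+ 19 / 40) * L₁) (*-monoˡ-≤ (decide≤ 0ℚ (+ 19 / 40)) 19L₀≤L₁) ⟩
    (+ 19 / 40) * L₁ + (+ 19 / 40) * L₁                 ≡⟨ collect L₁ ⟩
    (+ 19 / 20) * L₁ + (+ 1 / 20) * 0ℚ                  ≤⟨ +-monoʳ-≤ ((+ 19 / 20) * L₁) (*-monoˡ-≤ (decide≤ 0ℚ (+ 1 / 20)) L₀≥0) ⟩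
    (+ 19 / 20) * L₁ + (+ 1 / 20) * L₀                  ∎)
  where
  open ≤-Reasoning
  top>0 : 0ℚ < (+ 19 / 20) * L₁ + (+ 1 / 20) * L₀
  top>0 = combination-pos (+ 19 / 20) (+ 1 / 20) (decide< 0ℚ _) (decide≤ 0ℚ _) L₁>0 L₀≥0
  bottom>0 : 0ℚ < (+ 1 / 20) * L₁ + (+ 19 / 20) * L₀
  bottom>0 = combination-pos (+ 1 / 20) (+ 19 / 20) (decide< 0ℚ _) (decide≤ 0ℚ _) L₁>0 L₀≥0
  expand : ∀ L₁ L₀ → (+ 19 / 2) * ((+ 1 / 20) * L₁ + (+ 19 / 20) * L₀) ≡ (+ 19 / 40) * L₁ + (+ 19 / 40) * ((+ 19 / 1) * L₀)
  expand = solve 2 (λ x y → con (+ 19 / 2) :* (con (+ 1 / 20) :* x :+ con (+ 19 / 20) :* y)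
                      := con (+ 19 / 40) :* x :+ con (+ 19 / 40) :* (con (+ 19 / 1) :* y)) refl
  collect : ∀ L₁ → (+ 19 / 40) * L₁ + (+ 19 / 40) * L₁ ≡ (+ 19 / 20) * L₁ + (+ 1 / 20) * 0ℚ
  collect = solve 1 (λ x → con (+ 19 / 40) :* x :+ con (+ 19 / 40) :* x
                      := con (+ 19 / 20) :* x :+ con (+ 1 / 20) :* con 0ℚ) refl

-- ... and the odds for label 0 above the edge are still ≥ 1/19.
dissent-step : ∀ {L₁ L₀} → Dominates (+ 19 / 1) L₁ L₀ →
  Dominates (+ 1 / 19) (channel θ false L₁ L₀) (channel θ true L₁ L₀)
dissent-step {L₁} {L₀} (dominates _ L₁>0 L₀≥0 _) =
  dominates (decide≤ 0ℚ (+ 1 / 19)) top>0 (<⇒≤ bottom>0) (begin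
    (+ 1 / 19) * ((+ 19 / 20) * L₁ + (+ 1 / 20) * L₀) ≡⟨ expand L₁ L₀ ⟩
    (+ 1 / 20) * L₁ + (+ 1 / 380) * L₀                ≤⟨ +-monoʳ-≤ ((+ 1 / 20) * L₁) (*-monoʳ-≤ L₀≥0 (decide≤ (+ 1 / 380) (+ 19 / 20))) ⟩
    (+ 1 / 20) * L₁ + (+ 19 / 20) * L₀                ∎)
  where
  open ≤-Reasoning
  top>0 : 0ℚ < (+ 1 / 20) * L₁ + (+ 19 / 20) * L₀
  top>0 = combination-pos (+ 1 / 20) (+ 19 / 20) (decide< 0ℚ _) (decide≤ 0ℚ _) L₁>0 L₀≥0
  bottom>0 : 0ℚ < (+ 19 / 20) * L₁ + (+ 1 / 20) * L₀
  bottom>0 = combination-pos (+ 19 / 20) (+ 1 / 20) (decide< 0ℚ _) (decide≤ 0ℚ _) L₁>0 L₀≥0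
  expand : ∀ L₁ L₀ → (+ 1 / 19) * ((+ 19 / 20) * L₁ + (+ 1 / 20) * L₀) ≡ (+ 1 / 20) * L₁ + (+ 1 / 380) * L₀
  expand = solve 2 (λ x y → con (+ 1 / 19) :* (con (+ 19 / 20) :* x :+ con (+ 1 / 20) :* y)
                      := con (+ 1 / 20) :* x :+ con (+ 1 / 380) :* y) refl

childOdds : Bool → Bool → ℚ
childOdds true  true  = + 19 / 2
childOdds false false = + 19 / 2
childOdds true  false = + 1 / 19
childOdds false true  = + 1 / 19

child-favors : ∀ c v {L₁ L₀} → Favors c (+ 19 / 1) L₁ L₀ →
  Favors v (childOdds v c) (channel θ true L₁ L₀) (channel θ false L₁ L₀)
child-favors true  true  h = agree-step h
child-favors true  false h = dissent-step h
child-favors false false {L₁} {L₀} h =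
  subst₂ (Dominates (+ 19 / 2)) (channel-swap θ true L₁ L₀) (channel-swap θ false L₁ L₀) (agree-step h)
child-favors false true  {L₁} {L₀} h =
  subst₂ (Dominates (+ 1 / 19)) (channel-swap θ false L₁ L₀) (channel-swap θ true L₁ L₀) (dissent-step h)

Lk : (d : ℕ) → Bool → (Level 6 d → Bool) → ℚ
Lk d = likelihood 6 θ d

Signals : (d : ℕ) → (Level 6 d → Bool) → Bool → Set
Signals d x v = Favors v (+ 19 / 1) (Lk d true x) (Lk d false x)

pick : {A : Set} → Fin 6 → A → A → A → A
pick zero                                   a b c = a
pick (suc zero)                             a b c = a
pick (suc (suc zero))                       a b c = b
pick (suc (suc (suc zero)))                 a b c = b
pick (suc (suc (suc (suc zero))))           a b c = c
pick (suc (suc (suc (suc (suc zero)))))     a b c = c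

spread : {A : Set} {d : ℕ} → (Level 6 d → A) → (Level 6 d → A) → (Level 6 d → A) → Level 6 (suc d) → A
spread X Y Z (j ∷ u) = pick j X Y Z u

maj : Bool → Bool → Bool → Bool
maj true  true  _ = true
maj false false _ = false
maj true  false c = c
maj false true  c = c

-- At least two of the three pairs agree with the majority, and already
-- two agreeing pairs outweigh one dissenting pair: (19/2)⁴·(1/19)² ≥ 19.
majority-odds : ∀ a b c {v} → maj a b c ≡ v →
  + 19 / 1 ≤ prodFin 6 (λ j → pick j (childOdds v a) (childOdds v b) (childOdds v c))
majority-odds true  true  true  refl = decide≤ _ _
majority-odds true  true  false refl = decide≤ _ _
majority-odds false false true  refl = decide≤ _ _
majority-odds false false false refl = decide≤ _ _
majority-odds true  false true  refl = decide≤ _ _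
majority-odds true  false false refl = decide≤ _ _
majority-odds false true  true  refl = decide≤ _ _
majority-odds false true  false refl = decide≤ _ _

gadget : ∀ {d a b c v} (X Y Z : Level 6 d → Bool) → maj a b c ≡ v →
  Signals d X a → Signals d Y b → Signals d Z c → Signals (suc d) (spread X Y Z) v
gadget {d} {a} {b} {c} {v} X Y Z majority sX sY sZ =
  favors-weaken v (decide≤ 0ℚ _) (majority-odds a b c majority)
    (parent-favors 6 θ d (spread X Y Z) v (λ j → pick j (childOdds v a) (childOdds v b) (childOdds v c)) child)
  where
  child : ∀ j → Favors v (pick j (childOdds v a) (childOdds v b) (childOdds v c))
    (channel θ true  (Lk d true (pick j X Y Z)) (Lk d false (pick j X Y Z)))
    (channel θ false (Lk d true (pick j X Y Z)) (Lk d false (pick j X Y Z)))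
  child zero                               = child-favors a v sX
  child (suc zero)                         = child-favors a v sX
  child (suc (suc zero))                   = child-favors b v sY
  child (suc (suc (suc zero)))             = child-favors b v sY
  child (suc (suc (suc (suc zero))))       = child-favors c v sZ
  child (suc (suc (suc (suc (suc zero))))) = child-favors c v sZ

-- At depth 0 the leaf is the root: its likelihoods are 1 and 0.
certain : Dominates (+ 19 / 1) 1ℚ 0ℚ
certain = dominates (decide≤ 0ℚ _) (decide< 0ℚ 1ℚ) ≤-refl (decide≤ _ _)

-- Unanimity: needed so that constant labellings propagate upwards.
maj-idem : ∀ b → maj b b b ≡ b
maj-idem true  = refl
maj-idem false = refl

constant-signals : ∀ d b → Signals d (λ _ → b) b
constant-signals zero    true  = certain
constant-signals zero    false = certain
constant-signals (suc d) b     = gadget K K K (maj-idem b) s s s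
  where
  K : Level 6 d → Bool
  K _ = b
  s : Signals d K b
  s = constant-signals d b

signed : Bool → Bool → Bool
signed true  v = v
signed false v = not v

signed-not : ∀ pol v → signed (not pol) v ≡ signed pol (not v)
signed-not true  v     = refl
signed-not false true  = refl
signed-not false false = refl

-- Majority is self-dual, so it commutes with a polarity flip.
signed-maj : ∀ pol a b c → maj (signed pol a) (signed pol b) (signed pol c) ≡ signed pol (maj a b c)
signed-maj true  a     b     c = refl
signed-maj false true  true  c = refl
signed-maj false false false c = refl
signed-maj false true  false c = refl
signed-maj false false true  c = refl

and-as-maj : ∀ a b → maj a b false ≡ a ∧ b
and-as-maj true  true  = refl
and-as-maj true  false = refl
and-as-maj false true  = refl
and-as-maj false false = refl

or-as-maj : ∀ a b → maj a b true ≡ a ∨ b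
or-as-maj true  true  = refl
or-as-maj true  false = refl
or-as-maj false true  = refl
or-as-maj false false = refl

gate-majority : ∀ pol a b k {g v} → maj a b k ≡ g → signed pol g ≡ v →
  maj (signed pol a) (signed pol b) (signed pol k) ≡ v
gate-majority pol a b k g-eq v-eq = ≡-trans (signed-maj pol a b k) (≡-trans (cong (signed pol) g-eq) v-eq)

literal : ∀ {N} → Bool → Fin N → Literal N
literal true  = pos
literal false = neg

-- Leaf assignment realising the circuit (negated when pol = false):
-- NOT flips the polarity, AND/OR become majority gadgets with a constant.
build : ∀ {N d} → Bool → Circuit N d → Level 6 d → Literal N
build pol (input i)  _ = literal pol i
build pol (not-g c)    = build (not pol) c
build pol (and-g c c′) = spread (build pol c) (build pol c′) (λ _ → const (signed pol false))
build pol (or-g c c′)  = spread (build pol c) (build pol c′) (λ _ → const (signed pol true))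

labels : ∀ {N d} → Bool → Circuit N d → (Fin N → Bool) → Level 6 d → Bool
labels pol c y i = evalLit (build pol c i) y

realises : ∀ {N} d pol (c : Circuit N d) y {v} → signed pol (eval c y) ≡ v → Signals d (labels pol c y) v
realises d true  (input i) y refl = constant-signals d (y i)
realises d false (input i) y refl = constant-signals d (not (y i))
realises d pol (not-g c) y out =
  realises d (not pol) c y (≡-trans (signed-not pol (eval c y)) out)
realises (suc d) pol (and-g c c′) y out =
  gadget (labels pol c y) (labels pol c′ y) (λ _ → signed pol false)
    (gate-majority pol (eval c y) (eval c′ y) false (and-as-maj (eval c y) (eval c′ y)) out)
    (realises d pol c y refl) (realises d pol c′ y refl) (constant-signals d (signed pol false))
realises (suc d) pol (or-g c c′) y out =
  gadget (labels pol c y) (labels pol c′ y) (λ _ → signed pol true)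
    (gate-majority pol (eval c y) (eval c′ y) true (or-as-maj (eval c y) (eval c′ y)) out)
    (realises d pol c y refl) (realises d pol c′ y refl) (constant-signals d (signed pol true))

condProb-≡ : ∀ a b (b>0 : 0ℚ < b) → condProb a b * b ≡ a
condProb-≡ a b b>0 with b ≟ 0ℚ
... | yes b≡0 = ⊥-elim (<⇒≢ b>0 (sym b≡0))
... | no b≢0 = ≡-trans (*-assoc a _ b) (≡-trans (cong (a *_) (*-inverseˡ b {{b≠0}})) (*-identityʳ a))
  where
  b≠0 : NonZero b
  b≠0 = pos⇒nonZero b {{positive b>0}}

condProb-≥ : ∀ r a b → 0ℚ < b → r * b ≤ a → r ≤ condProb a b
condProb-≥ r a b b>0 rb≤a =
  *-cancelʳ-≤-pos b {{positive b>0}} (subst (r * b ≤_) (sym (condProb-≡ a b b>0)) rb≤a)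

condProb-≤ : ∀ r a b → 0ℚ < b → a ≤ r * b → condProb a b ≤ r
condProb-≤ r a b b>0 a≤rb =
  *-cancelʳ-≤-pos b {{positive b>0}} (subst (_≤ r * b) (sym (condProb-≡ a b b>0)) a≤rb)

posterior-high : ∀ {L₁ L₀} → Dominates (+ 19 / 1) L₁ L₀ →
  + 19 / 20 ≤ condProb (half * L₁) (half * L₁ + half * L₀)
posterior-high {L₁} {L₀} (dominates _ L₁>0 L₀≥0 19L₀≤L₁) =
  condProb-≥ _ _ _ (combination-pos half half (decide< 0ℚ half) (decide≤ 0ℚ half) L₁>0 L₀≥0) (begin
    (+ 19 / 20) * (half * L₁ + half * L₀)              ≡⟨ expand L₁ L₀ ⟩
    (+ 19 / 40) * L₁ + (+ 1 / 40) * ((+ 19 / 1) * L₀) ≤⟨ +-monoʳ-≤ ((+ 19 / 40) * L₁) (*-monoˡ-≤ (decide≤ 0ℚ (+ 1 / 40)) 19L₀≤L₁) ⟩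
    (+ 19 / 40) * L₁ + (+ 1 / 40) * L₁                ≡⟨ collect L₁ ⟩
    half * L₁                                          ∎)
  where
  open ≤-Reasoning
  expand : ∀ L₁ L₀ → (+ 19 / 20) * (half * L₁ + half * L₀) ≡ (+ 19 / 40) * L₁ + (+ 1 / 40) * ((+ 19 / 1) * L₀)
  expand = solve 2 (λ x y → con (+ 19 / 20) :* (con half :* x :+ con half :* y)
                      := con (+ 19 / 40) :* x :+ con (+ 1 / 40) :* (con (+ 19 / 1) :* y)) refl
  collect : ∀ L₁ → (+ 19 / 40) * L₁ + (+ 1 / 40) * L₁ ≡ half * L₁
  collect = solve 1 (λ x → con (+ 19 / 40) :* x :+ con (+ 1 / 40) :* x := con half :* x) refl

posterior-low : ∀ {L₁ L₀} → Dominates (+ 19 / 1) L₀ L₁ →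
  condProb (half * L₁) (half * L₁ + half * L₀) ≤ + 1 / 20
posterior-low {L₁} {L₀} (dominates _ L₀>0 L₁≥0 19L₁≤L₀) =
  condProb-≤ _ _ _ (+-mono-≤-< (*-nonNeg (decide≤ 0ℚ half) L₁≥0) (*-pos (decide< 0ℚ half) L₀>0)) (begin
    half * L₁                                         ≡⟨ split L₁ ⟩
    (+ 1 / 40) * L₁ + (+ 1 / 40) * ((+ 19 / 1) * L₁) ≤⟨ +-monoʳ-≤ ((+ 1 / 40) * L₁) (*-monoˡ-≤ (decide≤ 0ℚ (+ 1 / 40)) 19L₁≤L₀) ⟩
    (+ 1 / 40) * L₁ + (+ 1 / 40) * L₀                ≡⟨ collect L₁ L₀ ⟩
    (+ 1 / 20) * (half * L₁ + half * L₀)              ∎)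
  where
  open ≤-Reasoning
  split : ∀ L₁ → half * L₁ ≡ (+ 1 / 40) * L₁ + (+ 1 / 40) * ((+ 19 / 1) * L₁)
  split = solve 1 (λ x → con half :* x := con (+ 1 / 40) :* x :+ con (+ 1 / 40) :* (con (+ 19 / 1) :* x)) refl
  collect : ∀ L₁ L₀ → (+ 1 / 40) * L₁ + (+ 1 / 40) * L₀ ≡ (+ 1 / 20) * (half * L₁ + half * L₀)
  collect = solve 2 (λ x y → con (+ 1 / 40) :* x :+ con (+ 1 / 40) :* y
                      := con (+ 1 / 20) :* (con half :* x :+ con half :* y)) refl

mainTheorem3 : (N d : ℕ) → (C : Circuit N d) →
    Σ (Level 6 d → Literal N) (λ a →
      (y : Fin N → Bool) →
        (eval C y ≡ true → (+ 19 / 20) ≤ posteriorRootOne 6 (+ 9 / 10) d (λ i → evalLit (a i) y))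
      × (eval C y ≡ false → posteriorRootOne 6 (+ 9 / 10) d (λ i → evalLit (a i) y) ≤ (+ 1 / 20)))
mainTheorem3 N d C = build true C , λ y →
    (λ output≡1 → posterior-high (realises d true C y output≡1))
  , (λ output≡0 → posterior-low (realises d true C y output≡0))
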